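{- For every weight function $(w,w_0)$, subterm coefficient function $c$, subterm penalty function $p$, weight status $\varsigma$, quasi-precedence $\succsim$ and status $\sigma$, the order $\succ_{\mathrm{WPO}(\mathcal A_{\mathrm{mp}})}$ is a reduction order.
   Context: Terms over a finite signature $\Sigma$ and variables $\mathcal V$. Weight function $(w,w_0)$: $w:\Sigma\to\mathbb N$, $w_0\in\mathbb N$, $w(c)\ge w_0$ for constants. Subterm coefficient function: positive integers $c(f,i)$ for $f\in\Sigma_n$, $1\le i\le n$. Subterm penalty function: $p(f,i)\in\mathbb N$. Weight status $\varsigma$ maps each $f$ to $\mathrm{Pol}$ or $\mathrm{Max}$. $\mathcal A_{\mathrm{mp}}$: carrier $\{a\in\mathbb N\mid a\ge w_0\}$, usual $\ge,>$, $f_{\mathcal A}(a_1..a_n)=w(f)+\sum_i c(f,i)a_i$ if $\varsigma(f)=\mathrm{Pol}$ and $\max(w(f),\max_i(p(f,i)+a_i))$ if $\varsigma(f)=\mathrm{Max}$; on terms $s\ge_{\mathcal A}t$ ($>_{\mathcal A}$) iff $\hat\alpha(s)\ge\hat\alpha(t)$ ($>$) for all assignments. Quasi-precedence: quasi-order $\succsim$ on $\Sigma$ with well-founded strict part $\succ$, equivalence $\sim$. Status $\sigma$: $f\in\Sigma_n\mapsto$ permutation $[i_1..i_n]$, $\sigma(f)(s_1..s_n)=[s_{i_1},..,s_{i_n}]$. Lex extension of strict $\succ$ (reflexive closure $\succeq$): $[s_1..s_n]\succ^{\mathrm{lex}}[t_1..t_m]$ iff there is $k<n$ with $s_i\succeq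 t_i$ ($i\le k$) and either $k=m$, or $k<m$ and $s_{k+1}\succ t_{k+1}$. WPO: no variable is greater than any term; $s=f(s_1..s_n)\succ_{\mathrm{WPO}(\mathcal A)}t$ iff (1) $s>_{\mathcal A}t$, or (2) $s\ge_{\mathcal A}t$ and either $s_i\succeq_{\mathrm{WPO}(\mathcal A)}t$ for some $i$, or $t=g(t_1..t_m)$, $s\succ_{\mathrm{WPO}(\mathcal A)}t_j$ for all $j$, and $f\succ g$ or ($f\sim g$ and $\sigma(f)(\vec s)\succ^{\mathrm{lex}}_{\mathrm{WPO}(\mathcal A)}\sigma(g)(\vec t)$). A reduction order is a well-founded, monotonic and stable strict order on terms. -}

module Defs where

open import Level using (0ℓ)
open import Data.Nat using (ℕ; zero; suc; _+_; _*_; _≤_; _<_; _⊔_)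
open import Data.Fin using (Fin)
open import Data.Fin.Permutation using (Permutation′; _⟨$⟩ʳ_)
open import Data.Vec using (Vec; []; _∷_; lookup; tabulate; sum; foldr; toList; _[_]≔_)
open import Data.List using (List; []; _∷_)
open import Data.Product using (_×_; _,_; Σ)
open import Data.Sum using (_⊎_)
open import Relation.Binary.Core using (Rel)
open import Relation.Binary.PropositionalEquality using (_≡_)
open import Relation.Binary.Structures using (IsPreorder; IsStrictPartialOrder)
open import Relation.Nullary using (¬_)
open import Induction.WellFounded using (WellFounded)

data WeightStatus : Set where
  Pol Max : WeightStatus

module _ {S : Set} (_≿_ : Rel S 0ℓ) where

  StrictPart : Rel S 0ℓ
  StrictPart f g = f ≿ g × ¬ (g ≿ f)

  EquivPart : Rel S 0ℓ
  EquivPart f g = f ≿ g × g ≿ f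

  record IsQuasiPrecedence : Set where
    field
      isQuasiOrder : IsPreorder _≡_ _≿_
      strictWF     : WellFounded (λ g f → StrictPart f g)

-- Lexicographic extension of a strict relation _≻_ (reflexive closure
-- ⪰ = ≻ ∪ ≡).  [s₁..sₙ] ≻lex [t₁..tₘ] iff there is k < n with sᵢ ⪰ tᵢ for
-- i ≤ k and either k = m, or k < m and s_{k+1} ≻ t_{k+1}.
-- Inductive rendering (induction on k).

data Lex {A : Set} (_≻_ : Rel A 0ℓ) : Rel (List A) 0ℓ where
  lex-[] : ∀ {s ss} → Lex _≻_ (s ∷ ss) []
  lex-here : ∀ {s ss t ts} → s ≻ t → Lex _≻_ (s ∷ ss) (t ∷ ts)
  lex-next : ∀ {s ss t ts} → (s ≻ t ⊎ s ≡ t) → Lex _≻_ ss ts → Lex _≻_ (s ∷ ss) (t ∷ ts)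

module Terms {k : ℕ} (ar : Fin k → ℕ) (V : Set) where

  data Term : Set where
    var : V → Term
    app : (f : Fin k) → Vec Term (ar f) → Term

  mutual
    _⟪_⟫ : Term → (V → Term) → Term
    var x ⟪ θ ⟫ = θ x
    app f ts ⟪ θ ⟫ = app f (substs ts θ)

    substs : ∀ {n} → Vec Term n → (V → Term) → Vec Term n
    substs [] θ = []
    substs (t ∷ ts) θ = (t ⟪ θ ⟫) ∷ substs ts θ

  record ReductionOrder (_≻_ : Rel Term 0ℓ) : Set where
    field
      strictOrder  : IsStrictPartialOrder _≡_ _≻_
      wellFounded  : WellFounded (λ t s → s ≻ t)
      monotonic    : ∀ (f : Fin k) (ss : Vec Term (ar f)) (i : Fin (ar f)) {s t : Term} →
                     s ≻ t → app f (ss [ i ]≔ s) ≻ app f (ss [ i ]≔ t)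
      stable       : ∀ (θ : V → Term) {s t : Term} → s ≻ t → (s ⟪ θ ⟫) ≻ (t ⟪ θ ⟫)

  -- The algebra A_mp.  Carrier {a ∈ ℕ | a ≥ w₀}; assignments are maps
  -- V → ℕ whose values all are ≥ w₀.

  module Amp (w : Fin k → ℕ) (w₀ : ℕ)
             (c : (f : Fin k) → Fin (ar f) → ℕ)
             (p : (f : Fin k) → Fin (ar f) → ℕ)
             (ς : Fin k → WeightStatus) where

    interp : (f : Fin k) → Vec ℕ (ar f) → ℕ
    interp f as with ς f
    ... | Pol = w f + sum (tabulate (λ i → c f i * lookup as i))
    ... | Max = w f ⊔ foldr (λ _ → ℕ) _⊔_ 0 (tabulate (λ i → p f i + lookup as i))

    mutual
      eval : (V → ℕ) → Term → ℕ
      eval α (var x) = α x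
      eval α (app f ts) = interp f (evals α ts)

      evals : ∀ {n} → (V → ℕ) → Vec Term n → Vec ℕ n
      evals α [] = []
      evals α (t ∷ ts) = eval α t ∷ evals α ts

    Assignment : Set
    Assignment = Σ (V → ℕ) (λ α → ∀ x → w₀ ≤ α x)

    _≥A_ : Rel Term 0ℓ
    s ≥A t = ∀ (α : Assignment) → eval (Data.Product.proj₁ α) t ≤ eval (Data.Product.proj₁ α) s

    _>A_ : Rel Term 0ℓ
    s >A t = ∀ (α : Assignment) → eval (Data.Product.proj₁ α) t < eval (Data.Product.proj₁ α) s

  module WPO (w : Fin k → ℕ) (w₀ : ℕ)
             (c : (f : Fin k) → Fin (ar f) → ℕ)
             (p : (f : Fin k) → Fin (ar f) → ℕ)
             (ς : Fin k → WeightStatus)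
             (_≿_ : Rel (Fin k) 0ℓ)
             (σ : (f : Fin k) → Permutation′ (ar f)) where

    open Amp w w₀ c p ς

    applyStatus : (f : Fin k) → Vec Term (ar f) → List Term
    applyStatus f ss = toList (tabulate (λ j → lookup ss (σ f ⟨$⟩ʳ j)))

    data _≻_ : Rel Term 0ℓ where
      wpo1  : ∀ {f ss t} → app f ss >A t → app f ss ≻ t
      wpo2a : ∀ {f ss t} → app f ss ≥A t →
              (i : Fin (ar f)) → (lookup ss i ≻ t ⊎ lookup ss i ≡ t) →
              app f ss ≻ t
      wpo2b : ∀ {f ss g ts} → app f ss ≥A app g ts →
              (∀ j → app f ss ≻ lookup ts j) →
              (StrictPart _≿_ f g ⊎
                (EquivPart _≿_ f g × Lex _≻_ (applyStatus f ss) (applyStatus g ts))) →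
              app f ss ≻ app g ts

-- Every rule of WPO(A_mp) demands s ≥_A t, and A_mp is weakly monotone and
-- weakly simple (c(f,i) > 0), so s ≻ t implies s ≥_A t and s ≥_A s|ᵢ; with
-- this, transitivity, stability and monotonicity follow by induction on
-- derivations.  Stability needs the carrier {a | a ≥ w₀} to be closed under
-- the interpretation, which is where w(c) ≥ w₀ for constants enters.
-- Well-foundedness is a triple induction: on the weight of a term under the
-- constant assignment w₀ (rule 1 decreases it), then on the precedence class
-- of the head symbol, then lexicographically on the status list of the
-- arguments, which are accessible by the same argument and whose number is
-- bounded by the largest arity.

module Submission where

open import Defs
open import Level using (0ℓ)
open import Function using (_∘_; flip)
open import Data.Nat using (ℕ; zero; suc; _+_; _*_; _⊔_; _≤_; _<_; s≤s; >-nonZero)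
open import Data.Nat.Properties
open import Data.Fin using (Fin; fromℕ<) renaming (zero to fzero; suc to fsuc)
open import Data.Fin.Properties using () renaming (_≟_ to _≟ᶠ_)
open import Data.Fin.Permutation using (Permutation′; _⟨$⟩ʳ_; _⟨$⟩ˡ_; inverseʳ)
open import Data.Vec using (Vec; []; _∷_; lookup; tabulate; toList; sum; foldr; map; _[_]≔_)
open import Data.Vec.Properties
  using (lookup∘update; lookup∘update′; tabulate-cong; tabulate-∘; toList-map; length-toList)
open import Data.Vec.Relation.Unary.All.Properties using (tabulate⁺; toList⁺)
open import Data.List as List using (List; []; _∷_; length)
open import Data.List.Relation.Unary.All using (All; _∷_)
open import Data.Product using (_×_; _,_)
open import Data.Sum using (_⊎_; inj₁; inj₂)
open import Relation.Nullary using (yes; no)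
open import Relation.Binary.Core using (Rel)
open import Relation.Binary.Definitions using (Transitive)
open import Relation.Binary.PropositionalEquality
  using (_≡_; refl; sym; trans; cong; cong₂; subst; subst₂; resp₂; isEquivalence; module ≡-Reasoning)
open import Relation.Binary.Structures using (IsPreorder)
open import Induction.WellFounded using (WellFounded; Acc; acc; acc-inverse; wf⇒irrefl)

_⁼ : ∀ {A : Set} → Rel A 0ℓ → Rel A 0ℓ
(R ⁼) x y = R x y ⊎ x ≡ y

≤-sum-tabulate : ∀ {n} (h : Fin n → ℕ) (i : Fin n) → h i ≤ sum (tabulate h)
≤-sum-tabulate h fzero    = m≤m+n _ _
≤-sum-tabulate h (fsuc i) = m≤n⇒m≤o+n (h fzero) (≤-sum-tabulate (h ∘ fsuc) i)

sum-tabulate-mono-≤ : ∀ {n} {h h′ : Fin n → ℕ} → (∀ i → h i ≤ h′ i) →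
                      sum (tabulate h) ≤ sum (tabulate h′)
sum-tabulate-mono-≤ {zero}  h≤h′ = ≤-refl
sum-tabulate-mono-≤ {suc n} h≤h′ = +-mono-≤ (h≤h′ fzero) (sum-tabulate-mono-≤ (h≤h′ ∘ fsuc))

max-tabulate : ∀ {n} → (Fin n → ℕ) → ℕ
max-tabulate h = foldr (λ _ → ℕ) _⊔_ 0 (tabulate h)

≤-max-tabulate : ∀ {n} (h : Fin n → ℕ) (i : Fin n) → h i ≤ max-tabulate h
≤-max-tabulate h fzero    = m≤m⊔n _ _
≤-max-tabulate h (fsuc i) = m≤n⇒m≤o⊔n (h fzero) (≤-max-tabulate (h ∘ fsuc) i)

max-tabulate-mono-≤ : ∀ {n} {h h′ : Fin n → ℕ} → (∀ i → h i ≤ h′ i) →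
                      max-tabulate h ≤ max-tabulate h′
max-tabulate-mono-≤ {zero}  h≤h′ = ≤-refl
max-tabulate-mono-≤ {suc n} h≤h′ = ⊔-mono-≤ (h≤h′ fzero) (max-tabulate-mono-≤ (h≤h′ ∘ fsuc))

toList-tabulate-map : ∀ {A B : Set} {n} (g : A → B) {a : Fin n → A} {b : Fin n → B} →
                      (∀ j → b j ≡ g (a j)) →
                      toList (tabulate b) ≡ List.map g (toList (tabulate a))
toList-tabulate-map g {a} {b} b≗ga = begin
  toList (tabulate b)               ≡⟨ cong toList (tabulate-cong b≗ga) ⟩
  toList (tabulate (g ∘ a))         ≡⟨ cong toList (tabulate-∘ g a) ⟩
  toList (map g (tabulate a))       ≡⟨ toList-map g (tabulate a) ⟩
  List.map g (toList (tabulate a))  ∎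
  where open ≡-Reasoning

lookup-update-⁼ : ∀ {A : Set} {R : Rel A 0ℓ} {n} (xs : Vec A n) (i j : Fin n) {s t : A} →
                  R s t → (R ⁼) (lookup (xs [ i ]≔ s) j) (lookup (xs [ i ]≔ t) j)
lookup-update-⁼ {R = R} xs i j {s} {t} s≻t with i ≟ᶠ j
... | yes refl = inj₁ (subst₂ R (sym (lookup∘update i xs s)) (sym (lookup∘update i xs t)) s≻t)
... | no i≢j   =
  inj₂ (trans (lookup∘update′ (i≢j ∘ sym) xs s) (sym (lookup∘update′ (i≢j ∘ sym) xs t)))

Lex-tabulate : ∀ {A : Set} {R : Rel A 0ℓ} {n} (a b : Fin n → A) →
               (∀ j → (R ⁼) (a j) (b j)) → ∀ j → R (a j) (b j) →
               Lex R (toList (tabulate a)) (toList (tabulate b))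
Lex-tabulate a b a⪰b fzero    aj≻bj = lex-here aj≻bj
Lex-tabulate a b a⪰b (fsuc j) aj≻bj =
  lex-next (a⪰b fzero) (Lex-tabulate (a ∘ fsuc) (b ∘ fsuc) (a⪰b ∘ fsuc) j aj≻bj)

Lex-permute : ∀ {A : Set} {R : Rel A 0ℓ} {n} (π : Permutation′ n) (xs ys : Vec A n) →
              (∀ j → (R ⁼) (lookup xs j) (lookup ys j)) → ∀ i → R (lookup xs i) (lookup ys i) →
              Lex R (toList (tabulate (λ j → lookup xs (π ⟨$⟩ʳ j))))
                    (toList (tabulate (λ j → lookup ys (π ⟨$⟩ʳ j))))
Lex-permute {R = R} π xs ys xs⪰ys i xᵢ≻yᵢ =
  Lex-tabulate _ _ (xs⪰ys ∘ (π ⟨$⟩ʳ_)) (π ⟨$⟩ˡ i)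
    (subst (λ k → R (lookup xs k) (lookup ys k)) (sym (inverseʳ π)) xᵢ≻yᵢ)

-- The length bound is essential: if b ≻ a then [b] ≻lex [a,b] ≻lex [a,a,b] ≻lex ⋯
module LexAcc {A : Set} (_≻_ : Rel A 0ℓ) where

  Admissible : ℕ → List A → Set
  Admissible N xs = length xs ≤ N × All (Acc (flip _≻_)) xs

  BoundedLex : ℕ → Rel (List A) 0ℓ
  BoundedLex N ys xs = Lex _≻_ xs ys × Admissible N ys

  mutual
    Lex-acc : ∀ {N xs} → Admissible N xs → Acc (BoundedLex N) xs
    Lex-acc {xs = []}     _                     = acc λ { (() , _) }
    Lex-acc {xs = x ∷ xs} (s≤s len , ax ∷ axs) = ∷-acc ax (Lex-acc (len , axs))

    ∷-acc : ∀ {N x xs} → Acc (flip _≻_) x → Acc (BoundedLex N) xs →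
            Acc (BoundedLex (suc N)) (x ∷ xs)
    ∷-acc ax axs = acc (∷-descend ax axs)

    ∷-descend : ∀ {N x xs} → Acc (flip _≻_) x → Acc (BoundedLex N) xs →
                ∀ {ys} → BoundedLex (suc N) ys (x ∷ xs) → Acc (BoundedLex (suc N)) ys
    ∷-descend _ _ {[]} _ = acc λ { (() , _) }
    ∷-descend (acc rx) _ {y ∷ ys} (lex-here x≻y , s≤s len , _ ∷ ays) =
      ∷-acc (rx x≻y) (Lex-acc (len , ays))
    ∷-descend (acc rx) _ {y ∷ ys} (lex-next (inj₁ x≻y) _ , s≤s len , _ ∷ ays) =
      ∷-acc (rx x≻y) (Lex-acc (len , ays))
    ∷-descend ax (acc rxs) {y ∷ ys} (lex-next (inj₂ refl) xs≻ys , s≤s len , _ ∷ ays) =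
      ∷-acc ax (rxs (xs≻ys , len , ays))

module QuasiOrderProperties {S : Set} {_≿_ : Rel S 0ℓ} (isQuasiOrder : IsPreorder _≡_ _≿_) where

  open IsPreorder isQuasiOrder renaming (refl to ≿-refl; trans to ≿-trans)

  StrictPart-trans : ∀ {f g h} → StrictPart _≿_ f g → StrictPart _≿_ g h → StrictPart _≿_ f h
  StrictPart-trans (f≿g , g⋡f) (g≿h , h⋡g) = ≿-trans f≿g g≿h , λ h≿f → h⋡g (≿-trans h≿f f≿g)

  StrictPart-EquivPart-trans : ∀ {f g h} → StrictPart _≿_ f g → EquivPart _≿_ g h →
                               StrictPart _≿_ f h
  StrictPart-EquivPart-trans (f≿g , g⋡f) (g≿h , h≿g) = ≿-trans f≿g g≿h , λ h≿f → g⋡f (≿-trans g≿h h≿f)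

  EquivPart-StrictPart-trans : ∀ {f g h} → EquivPart _≿_ f g → StrictPart _≿_ g h →
                               StrictPart _≿_ f h
  EquivPart-StrictPart-trans (f≿g , g≿f) (g≿h , h⋡g) = ≿-trans f≿g g≿h , λ h≿f → h⋡g (≿-trans h≿f f≿g)

  EquivPart-trans : ∀ {f g h} → EquivPart _≿_ f g → EquivPart _≿_ g h → EquivPart _≿_ f h
  EquivPart-trans (f≿g , g≿f) (g≿h , h≿g) = ≿-trans f≿g g≿h , ≿-trans h≿g g≿f

  EquivPart-sym : ∀ {f g} → EquivPart _≿_ f g → EquivPart _≿_ g f
  EquivPart-sym (f≿g , g≿f) = g≿f , f≿g

  EquivPart-refl : ∀ {f} → EquivPart _≿_ f f
  EquivPart-refl = ≿-refl , ≿-refl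

module WPOProperties {k : ℕ} (ar : Fin k → ℕ) (V : Set)
    (w : Fin k → ℕ) (w₀ : ℕ) (w-const≥w₀ : ∀ f → ar f ≡ 0 → w₀ ≤ w f)
    (c : (f : Fin k) → Fin (ar f) → ℕ) (c-positive : ∀ f i → 0 < c f i)
    (p : (f : Fin k) → Fin (ar f) → ℕ)
    (ς : Fin k → WeightStatus)
    (_≿_ : Rel (Fin k) 0ℓ) (isQuasiPrecedence : IsQuasiPrecedence _≿_)
    (σ : (f : Fin k) → Permutation′ (ar f)) where

  open Terms ar V
  open Amp w w₀ c p ς
  open WPO w w₀ c p ς _≿_ σ
  open IsQuasiPrecedence isQuasiPrecedence
  open QuasiOrderProperties isQuasiOrder

  interp-≥-arg : ∀ f (as : Vec ℕ (ar f)) i → lookup as i ≤ interp f as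
  interp-≥-arg f as i with ς f
  ... | Pol = m≤n⇒m≤o+n (w f) (≤-trans (m≤n*m (lookup as i) (c f i) {{>-nonZero (c-positive f i)}})
                                       (≤-sum-tabulate (λ j → c f j * lookup as j) i))
  ... | Max = m≤n⇒m≤o⊔n (w f) (≤-trans (m≤n+m (lookup as i) (p f i))
                                       (≤-max-tabulate (λ j → p f j + lookup as j) i))

  interp-≥-weight : ∀ f (as : Vec ℕ (ar f)) → w f ≤ interp f as
  interp-≥-weight f as with ς f
  ... | Pol = m≤m+n _ _
  ... | Max = m≤m⊔n _ _

  interp-mono-≤ : ∀ f (as bs : Vec ℕ (ar f)) → (∀ i → lookup as i ≤ lookup bs i) →
                  interp f as ≤ interp f bs
  interp-mono-≤ f as bs as≤bs with ς f
  ... | Pol = +-monoʳ-≤ (w f) (sum-tabulate-mono-≤ (λ i → *-monoʳ-≤ (c f i) (as≤bs i)))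
  ... | Max = ⊔-monoʳ-≤ (w f) (max-tabulate-mono-≤ (λ i → +-monoʳ-≤ (p f i) (as≤bs i)))

  lookup-evals : ∀ α {n} (ts : Vec Term n) i → lookup (evals α ts) i ≡ eval α (lookup ts i)
  lookup-evals α (t ∷ ts) fzero    = refl
  lookup-evals α (t ∷ ts) (fsuc i) = lookup-evals α ts i

  lookup-substs : ∀ θ {n} (ts : Vec Term n) i → lookup (substs ts θ) i ≡ lookup ts i ⟪ θ ⟫
  lookup-substs θ (t ∷ ts) fzero    = refl
  lookup-substs θ (t ∷ ts) (fsuc i) = lookup-substs θ ts i

  eval-≥-arg : ∀ α f (ss : Vec Term (ar f)) i → eval α (lookup ss i) ≤ eval α (app f ss)
  eval-≥-arg α f ss i =
    subst (_≤ interp f (evals α ss)) (lookup-evals α ss i) (interp-≥-arg f (evals α ss) i)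

  mutual
    eval-≥-w₀ : ∀ α → (∀ x → w₀ ≤ α x) → ∀ t → w₀ ≤ eval α t
    eval-≥-w₀ α α≥w₀ (var x) = α≥w₀ x
    eval-≥-w₀ α α≥w₀ (app f ss) with ar f ≟ 0
    ... | yes ar≡0 = ≤-trans (w-const≥w₀ f ar≡0) (interp-≥-weight f (evals α ss))
    ... | no  ar≢0 = ≤-trans (evals-≥-w₀ α α≥w₀ ss i) (interp-≥-arg f (evals α ss) i)
      where
      i : Fin (ar f)
      i = fromℕ< (n≢0⇒n>0 ar≢0)

    evals-≥-w₀ : ∀ α → (∀ x → w₀ ≤ α x) → ∀ {n} (ss : Vec Term n) i → w₀ ≤ lookup (evals α ss) i
    evals-≥-w₀ α α≥w₀ (t ∷ ss) fzero    = eval-≥-w₀ α α≥w₀ t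
    evals-≥-w₀ α α≥w₀ (t ∷ ss) (fsuc i) = evals-≥-w₀ α α≥w₀ ss i

  mutual
    eval-subst : ∀ α θ t → eval α (t ⟪ θ ⟫) ≡ eval (eval α ∘ θ) t
    eval-subst α θ (var x)    = refl
    eval-subst α θ (app f ts) = cong (interp f) (evals-subst α θ ts)

    evals-subst : ∀ α θ {n} (ts : Vec Term n) → evals α (substs ts θ) ≡ evals (eval α ∘ θ) ts
    evals-subst α θ []       = refl
    evals-subst α θ (t ∷ ts) = cong₂ _∷_ (eval-subst α θ t) (evals-subst α θ ts)

  ≥A-subst : ∀ θ s t → s ≥A t → (s ⟪ θ ⟫) ≥A (t ⟪ θ ⟫)
  ≥A-subst θ s t s≥t (α , α≥w₀) =
    subst₂ _≤_ (sym (eval-subst α θ t)) (sym (eval-subst α θ s))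
      (s≥t (eval α ∘ θ , eval-≥-w₀ α α≥w₀ ∘ θ))

  >A-subst : ∀ θ s t → s >A t → (s ⟪ θ ⟫) >A (t ⟪ θ ⟫)
  >A-subst θ s t s>t (α , α≥w₀) =
    subst₂ _<_ (sym (eval-subst α θ t)) (sym (eval-subst α θ s))
      (s>t (eval α ∘ θ , eval-≥-w₀ α α≥w₀ ∘ θ))

  app-mono-≥A : ∀ f (us vs : Vec Term (ar f)) → (∀ j → lookup us j ≥A lookup vs j) →
                app f us ≥A app f vs
  app-mono-≥A f us vs us≥vs (α , α≥w₀) =
    interp-mono-≤ f (evals α vs) (evals α us) λ j →
      subst₂ _≤_ (sym (lookup-evals α vs j)) (sym (lookup-evals α us j)) (us≥vs j (α , α≥w₀))

  ≻⇒≥A : ∀ {s t} → s ≻ t → s ≥A t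
  ≻⇒≥A (wpo1 s>t) α = <⇒≤ (s>t α)
  ≻⇒≥A (wpo2a s≥t _ _) = s≥t
  ≻⇒≥A (wpo2b s≥t _ _) = s≥t

  ⪰⇒≥A : ∀ {s t} → (_≻_ ⁼) s t → s ≥A t
  ⪰⇒≥A (inj₁ s≻t) = ≻⇒≥A s≻t
  ⪰⇒≥A (inj₂ refl) α = ≤-refl

  arg-⪰⇒≻ : ∀ f ss i {u} → (_≻_ ⁼) (lookup ss i) u → app f ss ≻ u
  arg-⪰⇒≻ f ss i sᵢ⪰u =
    wpo2a (λ (α , α≥w₀) → ≤-trans (⪰⇒≥A sᵢ⪰u (α , α≥w₀)) (eval-≥-arg α f ss i)) i sᵢ⪰u

  PrecLex : Fin k → List Term → Fin k → List Term → Set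
  PrecLex f xs g ys = StrictPart _≿_ f g ⊎ (EquivPart _≿_ f g × Lex _≻_ xs ys)

  mutual
    ≻-trans : Transitive _≻_
    ≻-trans (wpo1 s>t) t≻u = wpo1 λ α → ≤-<-trans (≻⇒≥A t≻u α) (s>t α)
    ≻-trans (wpo2a s≥t i sᵢ⪰t) t≻u =
      wpo2a (λ α → ≤-trans (≻⇒≥A t≻u α) (s≥t α)) i (inj₁ (⪰-≻-trans sᵢ⪰t t≻u))
    ≻-trans s≻t@(wpo2b _ _ _) (wpo1 t>u) = wpo1 λ α → <-≤-trans (t>u α) (≻⇒≥A s≻t α)
    ≻-trans (wpo2b _ s≻tⱼ _) (wpo2a _ j tⱼ⪰u) = ≻-⪰-trans (s≻tⱼ j) tⱼ⪰u
    ≻-trans s≻t@(wpo2b s≥t _ prec) (wpo2b t≥u t≻uⱼ prec′) =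
      wpo2b (λ α → ≤-trans (t≥u α) (s≥t α)) (λ j → ≻-trans s≻t (t≻uⱼ j)) (PrecLex-trans prec prec′)

    ⪰-≻-trans : ∀ {s t u} → (_≻_ ⁼) s t → t ≻ u → s ≻ u
    ⪰-≻-trans (inj₁ s≻t) t≻u = ≻-trans s≻t t≻u
    ⪰-≻-trans (inj₂ refl) t≻u = t≻u

    ≻-⪰-trans : ∀ {s t u} → s ≻ t → (_≻_ ⁼) t u → s ≻ u
    ≻-⪰-trans s≻t (inj₁ t≻u) = ≻-trans s≻t t≻u
    ≻-⪰-trans s≻t (inj₂ refl) = s≻t

    ⪰-trans : ∀ {s t u} → (_≻_ ⁼) s t → (_≻_ ⁼) t u → (_≻_ ⁼) s u
    ⪰-trans (inj₁ s≻t) t⪰u = inj₁ (≻-⪰-trans s≻t t⪰u)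
    ⪰-trans (inj₂ refl) t⪰u = t⪰u

    Lex-trans : ∀ {xs ys zs} → Lex _≻_ xs ys → Lex _≻_ ys zs → Lex _≻_ xs zs
    Lex-trans lex-[]           ()
    Lex-trans (lex-here _)     lex-[]           = lex-[]
    Lex-trans (lex-next _ _)   lex-[]           = lex-[]
    Lex-trans (lex-here x≻y)   (lex-here y≻z)   = lex-here (≻-trans x≻y y≻z)
    Lex-trans (lex-here x≻y)   (lex-next y⪰z _) = lex-here (≻-⪰-trans x≻y y⪰z)
    Lex-trans (lex-next x⪰y _) (lex-here y≻z)   = lex-here (⪰-≻-trans x⪰y y≻z)
    Lex-trans (lex-next x⪰y l) (lex-next y⪰z m) = lex-next (⪰-trans x⪰y y⪰z) (Lex-trans l m)

    PrecLex-trans : ∀ {f g h xs ys zs} → PrecLex f xs g ys → PrecLex g ys h zs → PrecLex f xs h zs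
    PrecLex-trans (inj₁ f≻g)       (inj₁ g≻h)       = inj₁ (StrictPart-trans f≻g g≻h)
    PrecLex-trans (inj₁ f≻g)       (inj₂ (g∼h , _)) = inj₁ (StrictPart-EquivPart-trans f≻g g∼h)
    PrecLex-trans (inj₂ (f∼g , _)) (inj₁ g≻h)       = inj₁ (EquivPart-StrictPart-trans f∼g g≻h)
    PrecLex-trans (inj₂ (f∼g , l)) (inj₂ (g∼h , m)) = inj₂ (EquivPart-trans f∼g g∼h , Lex-trans l m)

  applyStatus-subst : ∀ θ f (ss : Vec Term (ar f)) →
                      applyStatus f (substs ss θ) ≡ List.map (_⟪ θ ⟫) (applyStatus f ss)
  applyStatus-subst θ f ss = toList-tabulate-map (_⟪ θ ⟫) (λ j → lookup-substs θ ss (σ f ⟨$⟩ʳ j))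

  module _ (θ : V → Term) where

    mutual
      ≻-stable : ∀ {s t} → s ≻ t → (s ⟪ θ ⟫) ≻ (t ⟪ θ ⟫)
      ≻-stable {s} {t} (wpo1 s>t) = wpo1 (>A-subst θ s t s>t)
      ≻-stable {s@(app f ss)} {t} (wpo2a s≥t i sᵢ⪰t) =
        wpo2a (≥A-subst θ s t s≥t) i
          (subst (λ u → (_≻_ ⁼) u (t ⟪ θ ⟫)) (sym (lookup-substs θ ss i)) (⪰-stable sᵢ⪰t))
      ≻-stable {s@(app f ss)} {t@(app g ts)} (wpo2b s≥t s≻tⱼ prec) =
        wpo2b (≥A-subst θ s t s≥t)
          (λ j → subst (s ⟪ θ ⟫ ≻_) (sym (lookup-substs θ ts j)) (≻-stable (s≻tⱼ j)))
          (subst₂ (λ xs ys → PrecLex f xs g ys) (sym (applyStatus-subst θ f ss))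
                  (sym (applyStatus-subst θ g ts)) (PrecLex-stable prec))

      ⪰-stable : ∀ {s t} → (_≻_ ⁼) s t → (_≻_ ⁼) (s ⟪ θ ⟫) (t ⟪ θ ⟫)
      ⪰-stable (inj₁ s≻t) = inj₁ (≻-stable s≻t)
      ⪰-stable (inj₂ refl) = inj₂ refl

      Lex-stable : ∀ {xs ys} → Lex _≻_ xs ys → Lex _≻_ (List.map (_⟪ θ ⟫) xs) (List.map (_⟪ θ ⟫) ys)
      Lex-stable lex-[]            = lex-[]
      Lex-stable (lex-here x≻y)    = lex-here (≻-stable x≻y)
      Lex-stable (lex-next x⪰y l)  = lex-next (⪰-stable x⪰y) (Lex-stable l)

      PrecLex-stable : ∀ {f g xs ys} → PrecLex f xs g ys →
                       PrecLex f (List.map (_⟪ θ ⟫) xs) g (List.map (_⟪ θ ⟫) ys)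
      PrecLex-stable (inj₁ f≻g)       = inj₁ f≻g
      PrecLex-stable (inj₂ (f∼g , l)) = inj₂ (f∼g , Lex-stable l)

  ≻-monotonic : ∀ f (ss : Vec Term (ar f)) (i : Fin (ar f)) {s t} →
                s ≻ t → app f (ss [ i ]≔ s) ≻ app f (ss [ i ]≔ t)
  ≻-monotonic f ss i {s} {t} s≻t =
    wpo2b (app-mono-≥A f us vs (⪰⇒≥A ∘ pointwise))
          (λ j → arg-⪰⇒≻ f us j (pointwise j))
          (inj₂ (EquivPart-refl , Lex-permute (σ f) us vs pointwise i at-i))
    where
    us vs : Vec Term (ar f)
    us = ss [ i ]≔ s
    vs = ss [ i ]≔ t

    pointwise : ∀ j → (_≻_ ⁼) (lookup us j) (lookup vs j)
    pointwise j = lookup-update-⁼ {R = _≻_} ss i j s≻t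

    at-i : lookup us i ≻ lookup vs i
    at-i = subst₂ _≻_ (sym (lookup∘update i ss s)) (sym (lookup∘update i ss t)) s≻t

  weight : Term → ℕ
  weight = eval (λ _ → w₀)

  constant-w₀ : Assignment
  constant-w₀ = (λ _ → w₀) , (λ _ → ≤-refl)

  AccTerm : Term → Set
  AccTerm = Acc (flip _≻_)

  open LexAcc _≻_ using (Admissible; BoundedLex; Lex-acc)

  maxArity : ℕ
  maxArity = max-tabulate ar

  applyStatus-admissible : ∀ g (ts : Vec Term (ar g)) → (∀ j → AccTerm (lookup ts j)) →
                           Admissible maxArity (applyStatus g ts)
  applyStatus-admissible g ts acc-ts =
    subst (_≤ maxArity) (sym (length-toList (tabulate (λ j → lookup ts (σ g ⟨$⟩ʳ j)))))
      (≤-max-tabulate ar g) ,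
    toList⁺ (tabulate⁺ (λ j → acc-ts (σ g ⟨$⟩ʳ j)))

  module _ (n : ℕ) (acc-lighter : ∀ t → weight t < n → AccTerm t) where

    -- The precedence induction runs on a fixed representative f of the head's
    -- class, so that rule 2(b) steps to an equivalent head leave it unchanged.
    descend : ∀ {f} → Acc (flip (StrictPart _≿_)) f →
              ∀ {g ss} → EquivPart _≿_ g f → Acc (BoundedLex maxArity) (applyStatus g ss) →
              weight (app g ss) ≤ n → (∀ j → AccTerm (lookup ss j)) →
              ∀ {t} → app g ss ≻ t → AccTerm t
    descend _ _ _ weight≤n _ (wpo1 s>t) = acc-lighter _ (<-≤-trans (s>t constant-w₀) weight≤n)
    descend _ _ _ _ acc-ss (wpo2a _ i (inj₁ sᵢ≻t)) = acc-inverse (acc-ss i) sᵢ≻t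
    descend _ _ _ _ acc-ss (wpo2a _ i (inj₂ refl)) = acc-ss i
    descend acc-f@(acc f-below) g∼f acc-status weight≤n acc-ss {app h ts}
            (wpo2b s≥t s≻tⱼ (inj₁ g≻h)) =
      let acc-ts = λ j → descend acc-f g∼f acc-status weight≤n acc-ss (s≻tⱼ j) in
      acc (descend (f-below (EquivPart-StrictPart-trans (EquivPart-sym g∼f) g≻h)) EquivPart-refl
                   (Lex-acc (applyStatus-admissible h ts acc-ts))
                   (≤-trans (s≥t constant-w₀) weight≤n) acc-ts)
    descend acc-f g∼f acc-status@(acc status-below) weight≤n acc-ss {app h ts}
            (wpo2b s≥t s≻tⱼ (inj₂ (g∼h , status≻))) =
      let acc-ts = λ j → descend acc-f g∼f acc-status weight≤n acc-ss (s≻tⱼ j) in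
      acc (descend acc-f (EquivPart-trans (EquivPart-sym g∼h) g∼f)
                   (status-below (status≻ , applyStatus-admissible h ts acc-ts))
                   (≤-trans (s≥t constant-w₀) weight≤n) acc-ts)

    mutual
      acc-weight≤ : ∀ t → weight t ≤ n → AccTerm t
      acc-weight≤ (var x) _ = acc λ ()
      acc-weight≤ (app f ss) weight≤n =
        acc (descend (strictWF f) EquivPart-refl (Lex-acc (applyStatus-admissible f ss acc-ss))
                     weight≤n acc-ss)
        where
        acc-ss : ∀ j → AccTerm (lookup ss j)
        acc-ss j = acc-args-weight≤ ss j (≤-trans (eval-≥-arg (λ _ → w₀) f ss j) weight≤n)

      acc-args-weight≤ : ∀ {m} (ss : Vec Term m) j → weight (lookup ss j) ≤ n → AccTerm (lookup ss j)
      acc-args-weight≤ (t ∷ ss) fzero    = acc-weight≤ t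
      acc-args-weight≤ (t ∷ ss) (fsuc j) = acc-args-weight≤ ss j

  acc-weight< : ∀ n t → weight t < n → AccTerm t
  acc-weight< zero    t ()
  acc-weight< (suc n) t (s≤s weight≤n) = acc-weight≤ n (acc-weight< n) t weight≤n

  ≻-wellFounded : WellFounded (flip _≻_)
  ≻-wellFounded t = acc-weight< (suc (weight t)) t ≤-refl

  reductionOrder : ReductionOrder _≻_
  reductionOrder = record
    { strictOrder = record
      { isEquivalence = isEquivalence
      ; irrefl        = λ s≡t → wf⇒irrefl (resp₂ (flip _≻_)) sym ≻-wellFounded (sym s≡t)
      ; trans         = ≻-trans
      ; <-resp-≈      = resp₂ _≻_
      }
    ; wellFounded = ≻-wellFounded
    ; monotonic   = ≻-monotonic
    ; stable      = ≻-stable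
    }

corollary4 : ∀ {k : ℕ} (ar : Fin k → ℕ) (V : Set)
    (w : Fin k → ℕ) (w₀ : ℕ) → (∀ f → ar f ≡ 0 → w₀ ≤ w f) →
    (c : (f : Fin k) → Fin (ar f) → ℕ) → (∀ f i → 0 < c f i) →
    (p : (f : Fin k) → Fin (ar f) → ℕ) →
    (ς : Fin k → WeightStatus) →
    (_≿_ : Rel (Fin k) 0ℓ) → IsQuasiPrecedence _≿_ →
    (σ : (f : Fin k) → Permutation′ (ar f)) →
    Terms.ReductionOrder ar V (Terms.WPO._≻_ ar V w w₀ c p ς _≿_ σ)
corollary4 = WPOProperties.reductionOrder
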